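{- Let $(T_1,r_1)$ and $(T_2,r_2)$ be rooted trees with $V(T_1)\cap V(T_2)=\emptyset$, let $(T,r_1)=(T_1,r_1)\circ(T_2,r_2)$, let $f:V(T)\to\{0,1,2\}$, and let $f_1=f|_{V(T_1)}$, $f_2=f|_{V(T_2)}$. Then $(T,f,r_1)\in A$ if and only if $(T_1,f_1,r_1)\in A$ and $(T_2,f_2,r_2)\in C\cup D\cup E$.
   Context: For a graph (or forest) $G$, an independent Roman $\{2\}$-dominating function (IR2DF) is a function $f:V(G)\to\{0,1,2\}$ such that every vertex $v$ with $f(v)=0$ satisfies $\sum_{u\in N(v)}f(u)\ge 2$ and the set $\{v: f(v)>0\}$ is independent; the empty function on the empty graph is regarded as an IR2DF. A rooted tree is a pair $(T,r)$ with $T$ a tree and $r\in V(T)$. For rooted trees with disjoint vertex sets, the composition $(T_1,r_1)\circ(T_2,r_2)=(T,r_1)$ has $V(T)=V(T_1)\cup V(T_2)$ and $E(T)=E(T_1)\cup E(T_2)\cup\{r_1r_2\}$. For a rooted tree $(T,r)$ and $f:V(T)\to\{0,1,2\}$, let $IR2DF(T)$ be the set of IR2DFs of $T$, $IR2DF_r(T)=\{f: f\notin IR2DF(T)$ and $f|_{V(T)\setminus\{r\}}\in IR2DF(T-r)\}$, and $f(N[r])=\sum_{u\in N_T[r]}f(u)$. Define the classes of triples: $A=\{(T,f,r): f\in IR2DF(T), f(r)=2\}$; $B=\{(T,f,r): f\in IR2DF(T), f(r)=1\}$; $C=\{(T,f,r): f\in IR2DF(T), f(r)=0\}$; $D=\{(T,f,r):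 f\in IR2DF_r(T), f(N[r])=1\}$; $E=\{(T,f,r): f\in IR2DF_r(T), f(N[r])=0\}$. -}

module Defs where

open import Data.Nat using (ℕ; zero; suc; _+_; _*_; _∸_; _≤_)
open import Data.Fin using (Fin; zero; suc; toℕ; splitAt; _↑ˡ_; _↑ʳ_)
import Data.Fin as F
open import Data.Bool using (Bool; true; false; if_then_else_; _∧_; not)
open import Data.Sum using (_⊎_; inj₁; inj₂)
open import Data.Product using (_×_; Σ)
open import Data.Empty using (⊥)
open import Relation.Nullary using (¬_)
open import Relation.Nullary.Decidable using (⌊_⌋)
open import Relation.Binary.PropositionalEquality using (_≡_; _≢_)

Σ< : (n : ℕ) → (Fin n → ℕ) → ℕ
Σ< zero    g = 0
Σ< (suc n) g = g zero + Σ< n (λ i → g (suc i))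

Adj : ℕ → Set
Adj n = Fin n → Fin n → Bool

IsSimpleGraph : ∀ {n} → Adj n → Set
IsSimpleGraph {n} adj =
  (∀ u v → adj u v ≡ adj v u) × (∀ v → adj v v ≡ false)

data Reach {n} (adj : Adj n) : Fin n → Fin n → Set where
  here : ∀ {v} → Reach adj v v
  step : ∀ {u w v} → adj u w ≡ true → Reach adj w v → Reach adj u v

Connected : ∀ {n} → Adj n → Set
Connected {n} adj = ∀ (u v : Fin n) → Reach adj u v

b2n : Bool → ℕ
b2n true  = 1
b2n false = 0

degree : ∀ {n} → Adj n → Fin n → ℕ
degree {n} adj v = Σ< n (λ u → b2n (adj v u))

-- twice the number of edges
degSum : ∀ {n} → Adj n → ℕ
degSum {n} adj = Σ< n (degree adj)

IsTree : ∀ {n} → Adj n → Set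
IsTree {n} adj =
  IsSimpleGraph adj × (1 ≤ n) × Connected adj × (degSum adj ≡ 2 * (n ∸ 1))

Label : ℕ → Set
Label n = Fin n → Fin 3

val : Fin 3 → ℕ
val = toℕ

-- IR2DF of the subgraph induced by S (a Boolean predicate on vertices)
IsIR2DFOn : ∀ {n} → Adj n → (Fin n → Bool) → Label n → Set
IsIR2DFOn {n} adj S f =
  (∀ v → S v ≡ true → val (f v) ≡ 0 →
     2 ≤ Σ< n (λ u → if S u ∧ adj v u then val (f u) else 0))
  × (∀ u v → S u ≡ true → S v ≡ true → adj u v ≡ true →
       val (f u) ≢ 0 → val (f v) ≢ 0 → ⊥)

IsIR2DF : ∀ {n} → Adj n → Label n → Set
IsIR2DF adj f = IsIR2DFOn adj (λ _ → true) f

IsIR2DFMinus : ∀ {n} → Adj n → Fin n → Label n → Set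
IsIR2DFMinus adj r f = IsIR2DFOn adj (λ v → not ⌊ v F.≟ r ⌋) f

IsIR2DF-r : ∀ {n} → Adj n → Fin n → Label n → Set
IsIR2DF-r adj r f = ¬ IsIR2DF adj f × IsIR2DFMinus adj r f

closedNbhdSum : ∀ {n} → Adj n → Label n → Fin n → ℕ
closedNbhdSum {n} adj f r =
  val (f r) + Σ< n (λ u → if adj r u then val (f u) else 0)

ClassA ClassB ClassC ClassD ClassE : ∀ {n} → Adj n → Label n → Fin n → Set
ClassA adj f r = IsIR2DF adj f × val (f r) ≡ 2
ClassB adj f r = IsIR2DF adj f × val (f r) ≡ 1
ClassC adj f r = IsIR2DF adj f × val (f r) ≡ 0
ClassD adj f r = IsIR2DF-r adj r f × closedNbhdSum adj f r ≡ 1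
ClassE adj f r = IsIR2DF-r adj r f × closedNbhdSum adj f r ≡ 0

-- Composition (T1,r1) ∘ (T2,r2) on the disjoint vertex set Fin (n1 + n2):
-- vertices of T1 are  i ↑ˡ n2, vertices of T2 are  n1 ↑ʳ j.
compose : ∀ {n₁ n₂} → Adj n₁ → Fin n₁ → Adj n₂ → Fin n₂ → Adj (n₁ + n₂)
compose {n₁} {n₂} a₁ r₁ a₂ r₂ u v with splitAt n₁ u | splitAt n₁ v
... | inj₁ x | inj₁ y = a₁ x y
... | inj₂ x | inj₂ y = a₂ x y
... | inj₁ x | inj₂ y = ⌊ x F.≟ r₁ ⌋ ∧ ⌊ y F.≟ r₂ ⌋
... | inj₂ x | inj₁ y = ⌊ x F.≟ r₂ ⌋ ∧ ⌊ y F.≟ r₁ ⌋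

-- Put f(r₁) = 2. Independence of f on T forces f(r₂) = 0, and then the edge r₁r₂ changes the
-- neighbourhood sums only at r₂, where it adds f(r₁) = 2. So f is an IR2DF of T exactly when f₁
-- is an IR2DF of T₁ and f₂ vanishes at r₂, is independent and dominates every vertex of T₂ but
-- possibly r₂. The latter condition is C ∪ D ∪ E, according as r₂ is dominated in T₂ or its
-- neighbourhood carries weight 1 or 0; in class D the case f₂(r₂) = 1 cannot occur, since then
-- all neighbours of r₂ vanish and f₂ would be an IR2DF of T₂ after all.
module Submission where

open import Defs
open import Data.Nat using (ℕ; zero; suc; _+_; _≤_; _≤?_; z≤n; s≤s)
import Data.Nat as ℕ
open import Data.Nat.Properties
  using (≤-refl; ≤-trans; ≤-reflexive; +-mono-≤; +-assoc; +-identityʳ; m≤m+n; m≤n+m;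
         n≤0⇒n≡0; m+n≡0⇒m≡0; m+n≡0⇒n≡0; suc-injective)
open import Data.Fin using (Fin; _↑ˡ_; _↑ʳ_; splitAt)
import Data.Fin as Fin
open import Data.Fin.Properties using (splitAt-↑ˡ; splitAt-↑ʳ; splitAt⁻¹-↑ˡ; splitAt⁻¹-↑ʳ)
open import Data.Product using (_×_; _,_; proj₁; proj₂; map₂)
open import Data.Sum using (_⊎_; inj₁; inj₂)
open import Data.Bool using (Bool; true; false; not; _∧_; if_then_else_)
open import Data.Empty using (⊥; ⊥-elim)
open import Function using (_∘_; _⇔_; mk⇔; Equivalence)
open import Relation.Nullary using (¬_; yes; no)
open import Relation.Nullary.Decidable using (⌊_⌋; decidable-stable)
open import Relation.Binary.PropositionalEquality

Σ<-cong : ∀ {n} {g h : Fin n → ℕ} → (∀ i → g i ≡ h i) → Σ< n g ≡ Σ< n h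
Σ<-cong {zero}  e = refl
Σ<-cong {suc n} e = cong₂ _+_ (e Fin.zero) (Σ<-cong (e ∘ Fin.suc))

Σ<-mono : ∀ {n} {g h : Fin n → ℕ} → (∀ i → g i ≤ h i) → Σ< n g ≤ Σ< n h
Σ<-mono {zero}  e = z≤n
Σ<-mono {suc n} e = +-mono-≤ (e Fin.zero) (Σ<-mono (e ∘ Fin.suc))

Σ<-zero : ∀ {n} {g : Fin n → ℕ} → (∀ i → g i ≡ 0) → Σ< n g ≡ 0
Σ<-zero {zero}  e = refl
Σ<-zero {suc n} e rewrite e Fin.zero = Σ<-zero (e ∘ Fin.suc)

term≤Σ< : ∀ {n} (g : Fin n → ℕ) i → g i ≤ Σ< n g
term≤Σ< g Fin.zero = m≤m+n _ _
term≤Σ< {suc n} g (Fin.suc i) = ≤-trans (term≤Σ< (g ∘ Fin.suc) i) (m≤n+m _ _)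

Σ<-splitAt : ∀ m {n} (g : Fin (m + n) → ℕ) →
             Σ< (m + n) g ≡ Σ< m (g ∘ (_↑ˡ n)) + Σ< n (g ∘ (m ↑ʳ_))
Σ<-splitAt zero    g = refl
Σ<-splitAt (suc m) g =
  trans (cong (g Fin.zero +_) (Σ<-splitAt m (g ∘ Fin.suc))) (sym (+-assoc (g Fin.zero) _ _))

Σ<-if-cong : ∀ {n} {a b : Fin n → Bool} (g : Fin n → ℕ) → (∀ i → a i ≡ b i) →
             Σ< n (λ i → if a i then g i else 0) ≡ Σ< n (λ i → if b i then g i else 0)
Σ<-if-cong g e = Σ<-cong (λ i → cong (λ b → if b then g i else 0) (e i))

⌊≟⌋-refl : ∀ {k} (i : Fin k) → ⌊ i Fin.≟ i ⌋ ≡ true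
⌊≟⌋-refl i with i Fin.≟ i
... | yes _  = refl
... | no i≢i = ⊥-elim (i≢i refl)

⌊≟⌋-≢ : ∀ {k} {i j : Fin k} → i ≢ j → ⌊ i Fin.≟ j ⌋ ≡ false
⌊≟⌋-≢ {i = i} {j} i≢j with i Fin.≟ j
... | yes i≡j = ⊥-elim (i≢j i≡j)
... | no _    = refl

⌊≟⌋-sound : ∀ {k} (i j : Fin k) → ⌊ i Fin.≟ j ⌋ ≡ true → i ≡ j
⌊≟⌋-sound i j e with i Fin.≟ j
... | yes i≡j = i≡j

not⌊≟⌋-sound : ∀ {k} (i j : Fin k) → not ⌊ i Fin.≟ j ⌋ ≡ true → i ≢ j
not⌊≟⌋-sound i j e with i Fin.≟ j
... | no i≢j = i≢j

∧-elimˡ : ∀ a {b} → a ∧ b ≡ true → a ≡ true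
∧-elimˡ true  _ = refl

∧-elimʳ : ∀ a {b} → a ∧ b ≡ true → b ≡ true
∧-elimʳ true e = e

≱2⇒≡0⊎≡1 : ∀ k → ¬ 2 ≤ k → k ≡ 0 ⊎ k ≡ 1
≱2⇒≡0⊎≡1 zero          _ = inj₁ refl
≱2⇒≡0⊎≡1 (suc zero)    _ = inj₂ refl
≱2⇒≡0⊎≡1 (suc (suc k)) h = ⊥-elim (h (s≤s (s≤s z≤n)))

m+n≡1⇒n≡0 : ∀ m {n} → m + n ≡ 1 → m ≢ 0 → n ≡ 0
m+n≡1⇒n≡0 zero    _ m≢0 = ⊥-elim (m≢0 refl)
m+n≡1⇒n≡0 (suc m) e _   = m+n≡0⇒n≡0 m (suc-injective e)

neighbourSum : ∀ {n} → Adj n → Label n → Fin n → ℕ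
neighbourSum {n} adj f v = Σ< n (λ u → if adj v u then val (f u) else 0)

Dominating : ∀ {n} → Adj n → Label n → Set
Dominating adj f = ∀ v → val (f v) ≡ 0 → 2 ≤ neighbourSum adj f v

DominatingExcept : ∀ {n} → Adj n → Fin n → Label n → Set
DominatingExcept adj r f = ∀ v → v ≢ r → val (f v) ≡ 0 → 2 ≤ neighbourSum adj f v

Independent : ∀ {n} → Adj n → Label n → Set
Independent adj f = ∀ u v → adj u v ≡ true → val (f u) ≢ 0 → val (f v) ≢ 0 → ⊥

IndependentExcept : ∀ {n} → Adj n → Fin n → Label n → Set
IndependentExcept adj r f =
  ∀ u v → u ≢ r → v ≢ r → adj u v ≡ true → val (f u) ≢ 0 → val (f v) ≢ 0 → ⊥

IsIR2DFVanishingAt : ∀ {n} → Adj n → Fin n → Label n → Set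
IsIR2DFVanishingAt adj r f = val (f r) ≡ 0 × DominatingExcept adj r f × Independent adj f

module _ {n : ℕ} {adj : Adj n} {f : Label n} where

  mkIR2DF : Dominating adj f → Independent adj f → IsIR2DF adj f
  mkIR2DF dom ind = (λ v _ → dom v) , (λ u v _ _ → ind u v)

  IR2DF-dominating : IsIR2DF adj f → Dominating adj f
  IR2DF-dominating (dom , _) v = dom v refl

  IR2DF-independent : IsIR2DF adj f → Independent adj f
  IR2DF-independent (_ , ind) u v = ind u v refl refl

  neighbour≤neighbourSum : ∀ {v u} → adj v u ≡ true → val (f u) ≤ neighbourSum adj f v
  neighbour≤neighbourSum {v} {u} e =
    subst (λ b → (if b then val (f u) else 0) ≤ neighbourSum adj f v) e (term≤Σ< _ u)

  independent-edge : Independent adj f → ∀ {u v} → adj u v ≡ true →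
                     val (f u) ≢ 0 → val (f v) ≡ 0
  independent-edge ind e fu≢0 = decidable-stable (_ ℕ.≟ 0) (ind _ _ e fu≢0)

  independentExcept-vanishing : ∀ {r} → val (f r) ≡ 0 →
                                IndependentExcept adj r f → Independent adj f
  independentExcept-vanishing {r} fr≡0 ind u v e fu≢0 fv≢0 =
    ind u v (λ { refl → fu≢0 fr≡0 }) (λ { refl → fv≢0 fr≡0 }) e fu≢0 fv≢0

  module _ {r : Fin n} where

    private
      sumExcept : Fin n → ℕ
      sumExcept v = Σ< n (λ u → if not ⌊ u Fin.≟ r ⌋ ∧ adj v u then val (f u) else 0)

      sumExcept≤neighbourSum : ∀ v → sumExcept v ≤ neighbourSum adj f v
      sumExcept≤neighbourSum v = Σ<-mono pointwise
        where
        pointwise : ∀ u → (if not ⌊ u Fin.≟ r ⌋ ∧ adj v u then val (f u) else 0)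
                          ≤ (if adj v u then val (f u) else 0)
        pointwise u with u Fin.≟ r
        ... | yes _ = z≤n
        ... | no _  = ≤-refl

      neighbourSum≡sumExcept : val (f r) ≡ 0 → ∀ v → neighbourSum adj f v ≡ sumExcept v
      neighbourSum≡sumExcept fr≡0 v = Σ<-cong pointwise
        where
        pointwise : ∀ u → (if adj v u then val (f u) else 0)
                          ≡ (if not ⌊ u Fin.≟ r ⌋ ∧ adj v u then val (f u) else 0)
        pointwise u with u Fin.≟ r
        pointwise u | no _ = refl
        pointwise u | yes refl with adj v r
        ... | true  = fr≡0
        ... | false = refl

    IR2DFMinus-except : IsIR2DFMinus adj r f →
                        DominatingExcept adj r f × IndependentExcept adj r f
    IR2DFMinus-except (dom , ind) =
        (λ v v≢r fv≡0 → ≤-trans (dom v (offRoot v≢r) fv≡0) (sumExcept≤neighbourSum v))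
      , (λ u v u≢r v≢r → ind u v (offRoot u≢r) (offRoot v≢r))
      where
      offRoot : ∀ {v} → v ≢ r → not ⌊ v Fin.≟ r ⌋ ≡ true
      offRoot v≢r = cong not (⌊≟⌋-≢ v≢r)

    vanishing⇒IR2DFMinus : IsIR2DFVanishingAt adj r f → IsIR2DFMinus adj r f
    vanishing⇒IR2DFMinus (fr≡0 , dom , ind) =
        (λ v v≢r fv≡0 → subst (2 ≤_) (neighbourSum≡sumExcept fr≡0 v)
                                       (dom v (not⌊≟⌋-sound v r v≢r) fv≡0))
      , (λ u v _ _ → ind u v)

    IR2DFMinus⇒vanishing : val (f r) ≡ 0 → IsIR2DFMinus adj r f → IsIR2DFVanishingAt adj r f
    IR2DFMinus⇒vanishing fr≡0 minus =
      fr≡0 , proj₁ except , independentExcept-vanishing fr≡0 (proj₂ except)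
      where
      except : DominatingExcept adj r f × IndependentExcept adj r f
      except = IR2DFMinus-except minus

    IR2DFMinus-isolatedRoot : (∀ u v → adj u v ≡ adj v u) → val (f r) ≢ 0 →
                              neighbourSum adj f r ≡ 0 → IsIR2DFMinus adj r f → IsIR2DF adj f
    IR2DFMinus-isolatedRoot symmetric fr≢0 sum≡0 minus = mkIR2DF dom ind
      where
      dom′ : DominatingExcept adj r f
      dom′ = proj₁ (IR2DFMinus-except minus)
      ind′ : IndependentExcept adj r f
      ind′ = proj₂ (IR2DFMinus-except minus)
      neighbour-vanishes : ∀ {u} → adj r u ≡ true → val (f u) ≡ 0
      neighbour-vanishes e = n≤0⇒n≡0 (≤-trans (neighbour≤neighbourSum e) (≤-reflexive sum≡0))
      dom : Dominating adj f
      dom v fv≡0 = dom′ v (λ { refl → fr≢0 fv≡0 }) fv≡0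
      ind : Independent adj f
      ind u v e fu≢0 fv≢0 with u Fin.≟ r | v Fin.≟ r
      ... | yes refl | _        = fv≢0 (neighbour-vanishes e)
      ... | no _     | yes refl = fu≢0 (neighbour-vanishes (trans (symmetric r u) e))
      ... | no u≢r   | no v≢r   = ind′ u v u≢r v≢r e fu≢0 fv≢0

    classCDE⇔vanishing : (∀ u v → adj u v ≡ adj v u) →
                         (ClassC adj f r ⊎ ClassD adj f r ⊎ ClassE adj f r)
                         ⇔ IsIR2DFVanishingAt adj r f
    classCDE⇔vanishing symmetric = mk⇔ to from
      where
      to : ClassC adj f r ⊎ ClassD adj f r ⊎ ClassE adj f r → IsIR2DFVanishingAt adj r f
      to (inj₁ (ir , fr≡0)) =
        fr≡0 , (λ v _ → IR2DF-dominating ir v) , IR2DF-independent ir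
      to (inj₂ (inj₁ ((¬ir , minus) , closed≡1))) = IR2DFMinus⇒vanishing fr≡0 minus
        where
        fr≡0 : val (f r) ≡ 0
        fr≡0 = decidable-stable (_ ℕ.≟ 0) λ fr≢0 →
          ¬ir (IR2DFMinus-isolatedRoot symmetric fr≢0 (m+n≡1⇒n≡0 _ closed≡1 fr≢0) minus)
      to (inj₂ (inj₂ ((_ , minus) , closed≡0))) =
        IR2DFMinus⇒vanishing (m+n≡0⇒m≡0 _ closed≡0) minus
      from : IsIR2DFVanishingAt adj r f → ClassC adj f r ⊎ ClassD adj f r ⊎ ClassE adj f r
      from vanishing@(fr≡0 , dom , ind) with 2 ≤? neighbourSum adj f r
      ... | yes dominated = inj₁ (mkIR2DF dom′ ind , fr≡0)
        where
        dom′ : Dominating adj f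
        dom′ v fv≡0 with v Fin.≟ r
        ... | yes refl = dominated
        ... | no v≢r   = dom v v≢r fv≡0
      ... | no undominated = byWeight (≱2⇒≡0⊎≡1 _ undominated)
        where
        notIR2DF-r : IsIR2DF-r adj r f
        notIR2DF-r = (λ ir → undominated (IR2DF-dominating ir r fr≡0))
                   , vanishing⇒IR2DFMinus vanishing
        closed≡ : ∀ {k} → neighbourSum adj f r ≡ k → closedNbhdSum adj f r ≡ k
        closed≡ = trans (cong (_+ neighbourSum adj f r) fr≡0)
        byWeight : neighbourSum adj f r ≡ 0 ⊎ neighbourSum adj f r ≡ 1 →
                   ClassC adj f r ⊎ ClassD adj f r ⊎ ClassE adj f r
        byWeight (inj₁ sum≡0) = inj₂ (inj₂ (notIR2DF-r , closed≡ sum≡0))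
        byWeight (inj₂ sum≡1) = inj₂ (inj₁ (notIR2DF-r , closed≡ sum≡1))

data SplitView (n₁ n₂ : ℕ) : Fin (n₁ + n₂) → Set where
  inl : ∀ x → SplitView n₁ n₂ (x ↑ˡ n₂)
  inr : ∀ y → SplitView n₁ n₂ (n₁ ↑ʳ y)

splitView : ∀ n₁ n₂ v → SplitView n₁ n₂ v
splitView n₁ n₂ v with splitAt n₁ v in eq
... | inj₁ x = subst (SplitView n₁ n₂) (splitAt⁻¹-↑ˡ eq) (inl x)
... | inj₂ y = subst (SplitView n₁ n₂) (splitAt⁻¹-↑ʳ eq) (inr y)

module Composition {n₁ n₂ : ℕ} (T₁ : Adj n₁) (r₁ : Fin n₁) (T₂ : Adj n₂) (r₂ : Fin n₂)
                   (f : Label (n₁ + n₂)) where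

  T : Adj (n₁ + n₂)
  T = compose T₁ r₁ T₂ r₂

  f₁ : Label n₁
  f₁ = f ∘ (_↑ˡ n₂)

  f₂ : Label n₂
  f₂ = f ∘ (n₁ ↑ʳ_)

  compose-ˡˡ : ∀ x y → T (x ↑ˡ n₂) (y ↑ˡ n₂) ≡ T₁ x y
  compose-ˡˡ x y rewrite splitAt-↑ˡ n₁ x n₂ | splitAt-↑ˡ n₁ y n₂ = refl

  compose-ʳʳ : ∀ x y → T (n₁ ↑ʳ x) (n₁ ↑ʳ y) ≡ T₂ x y
  compose-ʳʳ x y rewrite splitAt-↑ʳ n₁ n₂ x | splitAt-↑ʳ n₁ n₂ y = refl

  compose-ˡʳ : ∀ x y → T (x ↑ˡ n₂) (n₁ ↑ʳ y) ≡ ⌊ x Fin.≟ r₁ ⌋ ∧ ⌊ y Fin.≟ r₂ ⌋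
  compose-ˡʳ x y rewrite splitAt-↑ˡ n₁ x n₂ | splitAt-↑ʳ n₁ n₂ y = refl

  compose-ʳˡ : ∀ y x → T (n₁ ↑ʳ y) (x ↑ˡ n₂) ≡ ⌊ y Fin.≟ r₂ ⌋ ∧ ⌊ x Fin.≟ r₁ ⌋
  compose-ʳˡ y x rewrite splitAt-↑ʳ n₁ n₂ y | splitAt-↑ˡ n₁ x n₂ = refl

  rootEdge : T (r₁ ↑ˡ n₂) (n₁ ↑ʳ r₂) ≡ true
  rootEdge = trans (compose-ˡʳ r₁ r₂) (cong₂ _∧_ (⌊≟⌋-refl r₁) (⌊≟⌋-refl r₂))

  rootEdge′ : T (n₁ ↑ʳ r₂) (r₁ ↑ˡ n₂) ≡ true
  rootEdge′ = trans (compose-ʳˡ r₂ r₁) (cong₂ _∧_ (⌊≟⌋-refl r₂) (⌊≟⌋-refl r₁))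

  crossEdge-ˡʳ : ∀ {x y} → T (x ↑ˡ n₂) (n₁ ↑ʳ y) ≡ true → y ≡ r₂
  crossEdge-ˡʳ {x} {y} e = ⌊≟⌋-sound y r₂ (∧-elimʳ _ (trans (sym (compose-ˡʳ x y)) e))

  crossEdge-ʳˡ : ∀ {y x} → T (n₁ ↑ʳ y) (x ↑ˡ n₂) ≡ true → y ≡ r₂
  crossEdge-ʳˡ {y} {x} e = ⌊≟⌋-sound y r₂ (∧-elimˡ _ (trans (sym (compose-ʳˡ y x)) e))

  private
    sumInto₁ sumInto₂ : Fin (n₁ + n₂) → ℕ
    sumInto₁ v = Σ< n₁ (λ i → if T v (i ↑ˡ n₂) then val (f₁ i) else 0)
    sumInto₂ v = Σ< n₂ (λ j → if T v (n₁ ↑ʳ j) then val (f₂ j) else 0)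

    neighbourSum-split : ∀ v → neighbourSum T f v ≡ sumInto₁ v + sumInto₂ v
    neighbourSum-split v = Σ<-splitAt n₁ _

    neighbourSum-ˡ : ∀ x → neighbourSum T f (x ↑ˡ n₂) ≡ neighbourSum T₁ f₁ x + sumInto₂ (x ↑ˡ n₂)
    neighbourSum-ˡ x = trans (neighbourSum-split _)
      (cong (_+ sumInto₂ (x ↑ˡ n₂)) (Σ<-if-cong (val ∘ f₁) (compose-ˡˡ x)))

    neighbourSum-ʳ : ∀ y → neighbourSum T f (n₁ ↑ʳ y) ≡ sumInto₁ (n₁ ↑ʳ y) + neighbourSum T₂ f₂ y
    neighbourSum-ʳ y = trans (neighbourSum-split _)
      (cong (sumInto₁ (n₁ ↑ʳ y) +_) (Σ<-if-cong (val ∘ f₂) (compose-ʳʳ y)))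

  neighbourSum-ˡ-≢ : ∀ {x} → x ≢ r₁ → neighbourSum T f (x ↑ˡ n₂) ≡ neighbourSum T₁ f₁ x
  neighbourSum-ˡ-≢ {x} x≢r₁ = begin
    neighbourSum T f (x ↑ˡ n₂)               ≡⟨ neighbourSum-ˡ x ⟩
    neighbourSum T₁ f₁ x + sumInto₂ (x ↑ˡ n₂) ≡⟨ cong (neighbourSum T₁ f₁ x +_) cross≡0 ⟩
    neighbourSum T₁ f₁ x + 0                  ≡⟨ +-identityʳ _ ⟩
    neighbourSum T₁ f₁ x                      ∎
    where
    open ≡-Reasoning
    cross≡0 : sumInto₂ (x ↑ˡ n₂) ≡ 0
    cross≡0 = trans
      (Σ<-if-cong (val ∘ f₂) (λ j → trans (compose-ˡʳ x j) (cong (_∧ _) (⌊≟⌋-≢ x≢r₁))))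
      (Σ<-zero {n₂} (λ _ → refl))

  neighbourSum-ʳ-≢ : ∀ {y} → y ≢ r₂ → neighbourSum T f (n₁ ↑ʳ y) ≡ neighbourSum T₂ f₂ y
  neighbourSum-ʳ-≢ {y} y≢r₂ = trans (neighbourSum-ʳ y) (cong (_+ neighbourSum T₂ f₂ y) cross≡0)
    where
    cross≡0 : sumInto₁ (n₁ ↑ʳ y) ≡ 0
    cross≡0 = trans
      (Σ<-if-cong (val ∘ f₁) (λ i → trans (compose-ʳˡ y i) (cong (_∧ _) (⌊≟⌋-≢ y≢r₂))))
      (Σ<-zero {n₁} (λ _ → refl))

  classA⇔ : ClassA T f (r₁ ↑ˡ n₂) ⇔ (ClassA T₁ f₁ r₁ × IsIR2DFVanishingAt T₂ r₂ f₂)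
  classA⇔ = mk⇔ to from
    where
    to : ClassA T f (r₁ ↑ˡ n₂) → ClassA T₁ f₁ r₁ × IsIR2DFVanishingAt T₂ r₂ f₂
    to (ir , fr₁≡2) = (mkIR2DF dom₁ ind₁ , fr₁≡2) , (fr₂≡0 , dom₂ , ind₂)
      where
      dom : Dominating T f
      dom = IR2DF-dominating ir
      ind : Independent T f
      ind = IR2DF-independent ir
      fr₁≢0 : val (f₁ r₁) ≢ 0
      fr₁≢0 rewrite fr₁≡2 = λ ()
      fr₂≡0 : val (f₂ r₂) ≡ 0
      fr₂≡0 = independent-edge ind rootEdge fr₁≢0
      dom₁ : Dominating T₁ f₁
      dom₁ x fx≡0 = subst (2 ≤_) (neighbourSum-ˡ-≢ (λ { refl → fr₁≢0 fx≡0 })) (dom _ fx≡0)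
      ind₁ : Independent T₁ f₁
      ind₁ x y e = ind _ _ (trans (compose-ˡˡ x y) e)
      dom₂ : DominatingExcept T₂ r₂ f₂
      dom₂ y y≢r₂ fy≡0 = subst (2 ≤_) (neighbourSum-ʳ-≢ y≢r₂) (dom _ fy≡0)
      ind₂ : Independent T₂ f₂
      ind₂ x y e = ind _ _ (trans (compose-ʳʳ x y) e)
    from : ClassA T₁ f₁ r₁ × IsIR2DFVanishingAt T₂ r₂ f₂ → ClassA T f (r₁ ↑ˡ n₂)
    from ((ir₁ , fr₁≡2) , (fr₂≡0 , dom₂ , ind₂)) = mkIR2DF dom ind , fr₁≡2
      where
      dom : Dominating T f
      dom v fv≡0 with splitView n₁ n₂ v
      ... | inl x = ≤-trans (IR2DF-dominating ir₁ x fv≡0)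
                            (subst (_ ≤_) (sym (neighbourSum-ˡ x)) (m≤m+n _ _))
      ... | inr y with y Fin.≟ r₂
      ...   | yes refl = subst (_≤ neighbourSum T f (n₁ ↑ʳ r₂)) fr₁≡2
                               (neighbour≤neighbourSum {adj = T} {f} rootEdge′)
      ...   | no y≢r₂  = subst (2 ≤_) (sym (neighbourSum-ʳ-≢ y≢r₂)) (dom₂ y y≢r₂ fv≡0)
      ind : Independent T f
      ind u v e with splitView n₁ n₂ u | splitView n₁ n₂ v
      ... | inl x | inl y = IR2DF-independent ir₁ x y (trans (sym (compose-ˡˡ x y)) e)
      ... | inr x | inr y = ind₂ x y (trans (sym (compose-ʳʳ x y)) e)
      ... | inl x | inr y with refl ← crossEdge-ˡʳ e = λ _ fv≢0 → fv≢0 fr₂≡0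
      ... | inr y | inl x with refl ← crossEdge-ʳˡ e = λ fu≢0 _ → fu≢0 fr₂≡0

lemma2 : ∀ {n₁ n₂ : ℕ} (T₁ : Adj n₁) (r₁ : Fin n₁) (T₂ : Adj n₂) (r₂ : Fin n₂)
    → IsTree T₁ → IsTree T₂
    → (f : Label (n₁ + n₂))
    → ClassA (compose T₁ r₁ T₂ r₂) f (r₁ ↑ˡ n₂)
    ⇔ (ClassA T₁ (f ∘ (_↑ˡ n₂)) r₁
    × (ClassC T₂ (f ∘ (n₁ ↑ʳ_)) r₂
    ⊎ ClassD T₂ (f ∘ (n₁ ↑ʳ_)) r₂
    ⊎ ClassE T₂ (f ∘ (n₁ ↑ʳ_)) r₂))
lemma2 T₁ r₁ T₂ r₂ _ ((symmetric₂ , _) , _) f =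
  mk⇔ (map₂ CDE.from ∘ to) (from ∘ map₂ CDE.to)
  where
  open Composition T₁ r₁ T₂ r₂ f using (classA⇔; f₂)
  open Equivalence classA⇔
  module CDE = Equivalence (classCDE⇔vanishing {f = f₂} {r = r₂} symmetric₂)
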